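{- Let $\mathbf{X}\in\mathbb{C}^{m\times\ell\times p}$, $\mathbf{Y}\in\mathbb{C}^{m\times n\times\ell}$, $\mathbf{Z}\in\mathbb{C}^{\ell\times n\times p}$. Suppose there are an index $0\le\tau<\ell$ and vectors $\mathbf{u}_t\in\mathbb{C}^m$, $\mathbf{v}_t\in\mathbb{C}^n$ ($0\le t<\ell$, $t\neq\tau$) such that for all $0\le k<p$, \[\mathrm{diag}(\mathbf{X}[:,\tau,k])\,\mathbf{Y}[:,:,\tau]\,\mathrm{diag}(\mathbf{Z}[\tau,:,k])=\sum_{0\le t<\ell,\ t\ne\tau}\Big[\mathrm{diag}(\mathbf{u}_t)\mathrm{diag}(\mathbf{X}[:,\tau,k])\mathbf{Y}[:,:,t]\mathrm{diag}(\mathbf{Z}[\tau,:,k])\mathrm{diag}(\mathbf{v}_t)+\mathrm{diag}(\mathbf{u}_t)\mathrm{diag}(\mathbf{X}[:,\tau,k])\mathbf{Y}[:,:,t]\mathrm{diag}(\mathbf{Z}[t,:,k])+\mathrm{diag}(\mathbf{X}[:,t,k])\mathbf{Y}[:,:,t]\mathrm{diag}(\mathbf{Z}[\tau,:,k])\mathrm{diag}(\mathbf{v}_t)\Big].\] Then $\mathrm{Prod}(\mathbf{X},\mathbf{Y},\mathbf{Z})$ has BM-rank at most $\ell-1$.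
   Context: For conformable $\mathbf{A}^{(0)}\in\mathbb{C}^{n_0\times \ell\times n_2}$, $\mathbf{A}^{(1)}\in\mathbb{C}^{n_0\times n_1\times \ell}$, $\mathbf{A}^{(2)}\in\mathbb{C}^{\ell\times n_1\times n_2}$, the Bhattacharya-Mesner product is $\mathrm{Prod}(\mathbf{A}^{(0)},\mathbf{A}^{(1)},\mathbf{A}^{(2)})[i_0,i_1,i_2]=\sum_{0\le j<\ell}\mathbf{A}^{(0)}[i_0,j,i_2]\mathbf{A}^{(1)}[i_0,i_1,j]\mathbf{A}^{(2)}[j,i_1,i_2]$. The BM-rank of $\mathbf{A}$ is the least $r$ such that $\mathbf{A}=\mathrm{Prod}(\mathbf{X}^{(0)},\mathbf{X}^{(1)},\mathbf{X}^{(2)})$ with contracted dimension $r$. Colon notation: $\mathbf{X}[:,t,k]\in\mathbb{C}^m$ is the vector obtained by fixing the 2nd and 3rd indices, $\mathbf{Y}[:,:,t]$ is the $m\times n$ matrix slice, $\mathbf{Z}[t,:,k]\in\mathbb{C}^n$; $\mathrm{diag}(\mathbf{x})$ is the diagonal matrix with diagonal $\mathbf{x}$. The left side of the hypothesis is the $k$-th depth slice of the $\tau$-th outer product term of $\mathrm{Prod}(\mathbf{X},\mathbf{Y},\mathbf{Z})$. -}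

module Defs where

open import Level using (_⊔_)
open import Algebra.Bundles using (CommutativeRing)
open import Data.Nat using (ℕ; zero; suc; _≤_)
open import Data.Fin using (Fin; zero; suc; _≟_)
open import Data.Product using (Σ; ∃; _×_; _,_)
open import Relation.Nullary using (does)
open import Data.Bool using (if_then_else_)

-- Tensors with entries in a commutative ring R (stand-in for ℂ).
module Tensors {c ℓr} (R : CommutativeRing c ℓr) where
  open CommutativeRing R using (Carrier; _≈_; _+_; _*_; 0#)

  Tensor : ℕ → ℕ → ℕ → Set c
  Tensor n₀ n₁ n₂ = Fin n₀ → Fin n₁ → Fin n₂ → Carrier

  Σ[<_] : (n : ℕ) → (Fin n → Carrier) → Carrier
  Σ[< zero ] f = 0#
  Σ[< suc n ] f = f zero + Σ[< n ] (λ j → f (suc j))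

  Σ≠ : {n : ℕ} → Fin n → (Fin n → Carrier) → Carrier
  Σ≠ {n} τ f = Σ[< n ] (λ t → if does (t ≟ τ) then 0# else f t)

  Prod : {n₀ n₁ n₂ l : ℕ} → Tensor n₀ l n₂ → Tensor n₀ n₁ l → Tensor l n₁ n₂
       → Tensor n₀ n₁ n₂
  Prod {l = l} A₀ A₁ A₂ i₀ i₁ i₂ =
    Σ[< l ] (λ j → A₀ i₀ j i₂ * A₁ i₀ i₁ j * A₂ j i₁ i₂)

  _≈T_ : {n₀ n₁ n₂ : ℕ} → Tensor n₀ n₁ n₂ → Tensor n₀ n₁ n₂ → Set ℓr
  A ≈T B = ∀ i₀ i₁ i₂ → A i₀ i₁ i₂ ≈ B i₀ i₁ i₂

  BMRankAtMost : {n₀ n₁ n₂ : ℕ} → ℕ → Tensor n₀ n₁ n₂ → Set (c ⊔ ℓr)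
  BMRankAtMost {n₀} {n₁} {n₂} r A =
    Σ ℕ λ r′ → r′ ≤ r ×
      Σ (Tensor n₀ r′ n₂) λ X₀ → Σ (Tensor n₀ n₁ r′) λ X₁ →
        Σ (Tensor r′ n₁ n₂) λ X₂ → Prod X₀ X₁ X₂ ≈T A

  -- Entry (i,j) of diag(a) M diag(b) is a i * M i j * b j; the hypothesis of
  -- the theorem, for a fixed depth k, written entrywise.
  Hyp : {m n l p : ℕ} → Tensor m l p → Tensor m n l → Tensor l n p
      → Fin l → (Fin l → Fin m → Carrier) → (Fin l → Fin n → Carrier) → Set ℓr
  Hyp {m} {n} {l} {p} X Y Z τ u v =
    (k : Fin p) (i : Fin m) (j : Fin n) →
      X i τ k * Y i j τ * Z τ j k ≈
      Σ≠ τ (λ t →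
          u t i * X i τ k * Y i j t * Z τ j k * v t j
        + u t i * X i τ k * Y i j t * Z t j k
        + X i t k * Y i j t * Z τ j k * v t j)

-- Every term τ of the BM product can be absorbed into the others: replacing
-- slice t of X by X[:,t,k] + u_t X[:,τ,k] and slice t of Z by
-- Z[t,:,k] + Z[τ,:,k] v_t (for t ≠ τ) and dropping index τ expands, term by
-- term, into the old term t plus the three summands of the hypothesis, so
-- the hypothesis is exactly what is needed to recover the missing term τ.
module Submission where

open import Defs
open import Algebra.Bundles using (CommutativeRing)
import Algebra.Properties.CommutativeMonoid.Sum as CommutativeMonoidSum
open import Data.Bool using (if_then_else_)
open import Data.Fin using (Fin; zero; suc; punchIn; _≟_)
open import Data.Fin.Properties using (punchInᵢ≢i)
open import Data.Nat using (ℕ; suc; _∸_)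
open import Data.Nat.Properties using (≤-refl)
open import Data.Product using (_,_)
open import Data.Vec.Functional using (removeAt)
open import Relation.Binary.PropositionalEquality using (_≡_; refl; cong)
import Relation.Binary.Reasoning.Setoid as SetoidReasoning
open import Relation.Nullary using (does; yes; no)
open import Relation.Nullary.Negation using (contradiction)

module BMRank {c ℓr} (R : CommutativeRing c ℓr) where
  open CommutativeRing R renaming (refl to ≈-refl) hiding (zero)
  open Tensors R
  open CommutativeMonoidSum +-commutativeMonoid using (sum; sum-cong-≋; sum-remove; ∑-distrib-+)
  open SetoidReasoning setoid

  Σ[<]≡sum : ∀ n (f : Fin n → Carrier) → Σ[< n ] f ≡ sum f
  Σ[<]≡sum ℕ.zero  f = refl
  Σ[<]≡sum (suc n) f = cong (f zero +_) (Σ[<]≡sum n (λ j → f (suc j)))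

  Σ≠≈sum-removeAt : ∀ {n} (τ : Fin (suc n)) (g : Fin (suc n) → Carrier) →
                    Σ≠ τ g ≈ sum (removeAt g τ)
  Σ≠≈sum-removeAt {n} τ g = begin
    Σ≠ τ g                                       ≡⟨ Σ[<]≡sum (suc n) g≠ ⟩
    sum g≠                                       ≈⟨ sum-remove g≠ ⟩
    g≠ τ + sum (removeAt g≠ τ)                   ≈⟨ +-cong g≠τ≈0 (sum-cong-≋ g≠≈g) ⟩
    0# + sum (removeAt g τ)                      ≈⟨ +-identityˡ _ ⟩
    sum (removeAt g τ)                           ∎
    where
    g≠ : Fin (suc n) → Carrier
    g≠ t = if does (t ≟ τ) then 0# else g t

    g≠τ≈0 : g≠ τ ≈ 0#
    g≠τ≈0 with τ ≟ τ
    ... | yes _  = ≈-refl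
    ... | no τ≢τ = contradiction refl τ≢τ

    g≠≈g : ∀ s → g≠ (punchIn τ s) ≈ g (punchIn τ s)
    g≠≈g s with punchIn τ s ≟ τ
    ... | yes eq = contradiction eq (punchInᵢ≢i τ s)
    ... | no _   = ≈-refl

  absorb-expand : ∀ a u x y z w v →
    (a + u * x) * y * (z + w * v) ≈
    a * y * z + (u * x * y * w * v + u * x * y * z + a * y * w * v)
  absorb-expand a u x y z w v = begin
    (a + u * x) * y * (z + w * v)
      ≈⟨ *-congʳ (distribʳ y a (u * x)) ⟩
    (a * y + u * x * y) * (z + w * v)
      ≈⟨ distribʳ (z + w * v) (a * y) (u * x * y) ⟩
    a * y * (z + w * v) + u * x * y * (z + w * v)
      ≈⟨ +-cong (distribˡ (a * y) z (w * v)) (distribˡ (u * x * y) z (w * v)) ⟩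
    (a * y * z + a * y * (w * v)) + (u * x * y * z + u * x * y * (w * v))
      ≈⟨ +-assoc _ _ _ ⟩
    a * y * z + (a * y * (w * v) + (u * x * y * z + u * x * y * (w * v)))
      ≈⟨ +-congˡ (+-comm _ _) ⟩
    a * y * z + ((u * x * y * z + u * x * y * (w * v)) + a * y * (w * v))
      ≈⟨ +-congˡ (+-cong (+-comm _ _) (*-assoc (a * y) w v) ) ⟨
    a * y * z + ((u * x * y * (w * v) + u * x * y * z) + a * y * w * v)
      ≈⟨ +-congˡ (+-congʳ (+-congʳ (*-assoc (u * x * y) w v))) ⟨
    a * y * z + (u * x * y * w * v + u * x * y * z + a * y * w * v) ∎

  module Absorb {m n l p : ℕ}
    (X : Tensor m (suc l) p) (Y : Tensor m n (suc l)) (Z : Tensor (suc l) n p)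
    (τ : Fin (suc l)) (u : Fin (suc l) → Fin m → Carrier) (v : Fin (suc l) → Fin n → Carrier)
    where

    X′ : Tensor m l p
    X′ i s k = X i (punchIn τ s) k + u (punchIn τ s) i * X i τ k

    Y′ : Tensor m n l
    Y′ i j s = Y i j (punchIn τ s)

    Z′ : Tensor l n p
    Z′ s j k = Z (punchIn τ s) j k + Z τ j k * v (punchIn τ s) j

    Prod-absorb : Hyp X Y Z τ u v → Prod X′ Y′ Z′ ≈T Prod X Y Z
    Prod-absorb H i j k = begin
      Prod X′ Y′ Z′ i j k                   ≡⟨ Σ[<]≡sum l _ ⟩
      sum (λ s → X′ i s k * Y′ i j s * Z′ s j k)
        ≈⟨ sum-cong-≋ absorbed-term ⟩
      sum (λ s → term (punchIn τ s) + hypTerm (punchIn τ s))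
        ≈⟨ ∑-distrib-+ (removeAt term τ) (removeAt hypTerm τ) ⟩
      sum (removeAt term τ) + sum (removeAt hypTerm τ)
        ≈⟨ +-congˡ (sym (Σ≠≈sum-removeAt τ hypTerm)) ⟩
      sum (removeAt term τ) + Σ≠ τ hypTerm  ≈⟨ +-congˡ (sym (H k i j)) ⟩
      sum (removeAt term τ) + term τ        ≈⟨ +-comm _ _ ⟩
      term τ + sum (removeAt term τ)        ≈⟨ sum-remove term ⟨
      sum term                              ≡⟨ Σ[<]≡sum (suc l) term ⟨
      Prod X Y Z i j k                      ∎
      where
      term : Fin (suc l) → Carrier
      term t = X i t k * Y i j t * Z t j k

      hypTerm : Fin (suc l) → Carrier
      hypTerm t = u t i * X i τ k * Y i j t * Z τ j k * v t j
                + u t i * X i τ k * Y i j t * Z t j k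
                + X i t k * Y i j t * Z τ j k * v t j

      absorbed-term : ∀ s → X′ i s k * Y′ i j s * Z′ s j k ≈
                            term (punchIn τ s) + hypTerm (punchIn τ s)
      absorbed-term s = absorb-expand (X i t k) (u t i) (X i τ k) (Y i j t) (Z t j k) (Z τ j k) (v t j)
        where t = punchIn τ s

theorem5 : ∀ {c ℓr} (R : CommutativeRing c ℓr) →
    let open CommutativeRing R using (Carrier) in
    let open Tensors R in
    {m n l p : ℕ} (X : Tensor m l p) (Y : Tensor m n l) (Z : Tensor l n p)
    (τ : Fin l) (u : Fin l → Fin m → Carrier) (v : Fin l → Fin n → Carrier) →
    Hyp X Y Z τ u v →
    BMRankAtMost (l ∸ 1) (Prod X Y Z)
-- No clause for l = 0: then τ : Fin 0 is impossible.
theorem5 R {l = suc l} X Y Z τ u v H = l , ≤-refl , X′ , Y′ , Z′ , Prod-absorb H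
  where open BMRank.Absorb R X Y Z τ u v
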